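{- (1) No RAM whose primitive operations are truncated subtraction $x\dot- y=\max(0,x-y)$ and Euclidean division over natural numbers computes the successor function $N\mapsto N+1$. (2) No RAM whose only primitive operation is multiplication computes the successor function $N\mapsto N+1$.
   Context: RAM with operation set $\mathtt{Op}$: registers holding natural numbers (accumulator $A$, buffer $B$, work registers $R[0],R[1],\dots$ initially $0$, input register $N$); instructions $\mathtt{CST}\ j$ ($A\gets j$ for a fixed integer $j$ appearing in the program), $B\gets A$, $R[A]\gets B$, $A\gets R[A]$, conditional jump on $A=0$, $A\gets N$, output $A$, and $A\gets\mathtt{op}(A,B)$ for $\mathtt{op}\in\mathtt{Op}$. The input is a single positive integer $N$. A RAM computes the successor function if, for every input $N>0$, it halts having output $N+1$. -}

module Defs where

open import Data.Nat using (ℕ; zero; suc; _+_; _*_; _∸_; _≟_; _/_; _<_)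
open import Data.List using (List; []; _∷_; [_]; _++_)
open import Data.Maybe using (Maybe; just; nothing)
open import Data.Product using (_×_; _,_; ∃)
open import Relation.Nullary using (yes; no)
open import Relation.Binary.PropositionalEquality using (_≡_)

data Instr (Op : Set) : Set where
  CST     : ℕ → Instr Op          -- A ← j
  B←A     : Instr Op
  R[A]←B  : Instr Op
  A←R[A]  : Instr Op
  JZ      : ℕ → Instr Op          -- if A = 0 then goto instruction number l
  A←N     : Instr Op
  OUT     : Instr Op
  OP      : Op → Instr Op         -- A ← op(A , B)

-- A program is a finite list of instructions, numbered 0,1,2,...
Program : Set → Set
Program Op = List (Instr Op)

-- Configuration: program counter, A, B, memory R, outputs so far.
record Config : Set where
  constructor cfg
  field
    pc  : ℕ
    acc : ℕ
    buf : ℕ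
    mem : ℕ → ℕ
    out : List ℕ

fetch : ∀ {Op} → Program Op → ℕ → Maybe (Instr Op)
fetch []       _       = nothing
fetch (i ∷ is) zero    = just i
fetch (i ∷ is) (suc k) = fetch is k

update : (ℕ → ℕ) → ℕ → ℕ → (ℕ → ℕ)
update f a v x with x ≟ a
... | yes _ = v
... | no  _ = f x

exec : ∀ {Op} → (Op → ℕ → ℕ → ℕ) → ℕ → Instr Op → Config → Config
exec ⟦_⟧ N (CST j)  (cfg p a b r o) = cfg (suc p) j b r o
exec ⟦_⟧ N B←A      (cfg p a b r o) = cfg (suc p) a a r o
exec ⟦_⟧ N R[A]←B   (cfg p a b r o) = cfg (suc p) a b (update r a b) o
exec ⟦_⟧ N A←R[A]   (cfg p a b r o) = cfg (suc p) (r a) b r o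
exec ⟦_⟧ N (JZ l)   (cfg p zero b r o)    = cfg l zero b r o
exec ⟦_⟧ N (JZ l)   (cfg p (suc a) b r o) = cfg (suc p) (suc a) b r o
exec ⟦_⟧ N A←N      (cfg p a b r o) = cfg (suc p) N b r o
exec ⟦_⟧ N OUT      (cfg p a b r o) = cfg (suc p) a b r (o ++ [ a ])
exec ⟦_⟧ N (OP f)   (cfg p a b r o) = cfg (suc p) (⟦ f ⟧ a b) b r o

-- Run for at most `fuel` steps; returns the list of outputs if the
-- machine has halted (program counter outside the program) by then.
run : ∀ {Op} → (Op → ℕ → ℕ → ℕ) → Program Op → ℕ → ℕ → Config → Maybe (List ℕ)
run ⟦_⟧ P N fuel c with fetch P (Config.pc c)
run ⟦_⟧ P N fuel       c | nothing = just (Config.out c)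
run ⟦_⟧ P N zero       c | just i  = nothing
run ⟦_⟧ P N (suc fuel) c | just i  = run ⟦_⟧ P N fuel (exec ⟦_⟧ N i c)

init : Config
init = cfg 0 0 0 (λ _ → 0) []

ComputesSucc : ∀ {Op} → (Op → ℕ → ℕ → ℕ) → Program Op → Set
ComputesSucc ⟦_⟧ P = ∀ N → 0 < N →
  ∃ λ fuel → run ⟦_⟧ P N fuel init ≡ just [ suc N ]

-- Euclidean division on ℕ, with the convention x div 0 = 0.
div : ℕ → ℕ → ℕ
div x zero    = 0
div x (suc y) = x / suc y

data SubDivOp : Set where
  monus quot : SubDivOp

⟦subdiv⟧ : SubDivOp → ℕ → ℕ → ℕ
⟦subdiv⟧ monus x y = x ∸ y
⟦subdiv⟧ quot  x y = div x y

data MulOp : Set where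
  mul : MulOp

⟦mul⟧ : MulOp → ℕ → ℕ → ℕ
⟦mul⟧ mul x y = x * y

-- Every value a RAM ever holds is built from 0, the program's constants and
-- the input N by the primitive operations, so any predicate that contains 0,
-- the constants and N and is closed under the operations holds of every
-- output.  With truncated subtraction and division, "v ≤ N" is such a
-- predicate as soon as N exceeds all constants.  With multiplication,
-- "v = 0 or v is coprime to N + 1" is one when N = c! for the largest
-- constant c.  Neither predicate holds of N + 1.
module Submission where

open import Defs
open import Data.Product using (_×_; _,_; proj₁; proj₂)
open import Data.Sum using (_⊎_; inj₁; inj₂)
open import Data.Nat using (ℕ; zero; suc; _*_; _≤_; _<_; _⊔_; z≤n; s≤s; _≟_; _!)
open import Data.Nat.Properties
open import Data.Nat.Divisibility
open import Data.Nat.DivMod using (m/n≤m)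
open import Data.Nat.GCD using (gcd; gcd[m,n]∣m; gcd[m,n]∣n)
open import Data.Nat.Coprimality using (Coprime; gcd≡1⇒coprime; coprime-divisor)
open import Data.List using ([]; _∷_; foldr)
open import Data.List.Relation.Unary.All using (All; []; _∷_)
open import Data.List.Relation.Unary.All.Properties using (++⁺)
open import Data.Maybe using (just; nothing)
open import Relation.Nullary using (¬_; yes; no)
open import Relation.Binary.PropositionalEquality using (_≡_; refl; sym; subst)

constant : ∀ {Op} → Instr Op → ℕ
constant (CST j) = j
constant _       = 0

maxConstant : ∀ {Op} → Program Op → ℕ
maxConstant = foldr (λ i m → constant i ⊔ m) 0

fetch-CST⇒≤maxConstant : ∀ {Op} (P : Program Op) k {j} →
                         fetch P k ≡ just (CST j) → j ≤ maxConstant P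
fetch-CST⇒≤maxConstant (CST j ∷ P) zero    refl = m≤m⊔n j (maxConstant P)
fetch-CST⇒≤maxConstant (i ∷ P)     (suc k) e    =
  ≤-trans (fetch-CST⇒≤maxConstant P k e) (m≤n⊔m (constant i) (maxConstant P))

record Invariant {Op : Set} (⟦_⟧ : Op → ℕ → ℕ → ℕ) (P : Program Op) (N : ℕ) : Set₁ where
  field
    Holds          : ℕ → Set
    zero-holds     : Holds 0
    constant-holds : ∀ {k j} → fetch P k ≡ just (CST j) → Holds j
    input-holds    : Holds N
    op-preserves   : ∀ f {a b} → Holds a → Holds b → Holds (⟦ f ⟧ a b)

module _ {Op : Set} {⟦_⟧ : Op → ℕ → ℕ → ℕ} {P : Program Op} {N : ℕ}
         (I : Invariant ⟦_⟧ P N) where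
  open Invariant I

  HoldsIn : Config → Set
  HoldsIn (cfg _ a b r o) = Holds a × Holds b × (∀ x → Holds (r x)) × All Holds o

  update-preserves : ∀ r a {b} → (∀ x → Holds (r x)) → Holds b →
                     ∀ x → Holds (update r a b x)
  update-preserves r a hr hb x with x ≟ a
  ... | yes _ = hb
  ... | no  _ = hr x

  exec-preserves : ∀ i c → Holds (constant i) → HoldsIn c → HoldsIn (exec ⟦_⟧ N i c)
  exec-preserves (CST j)  (cfg p a b r o)       hj (ha , hb , hr , ho) = hj , hb , hr , ho
  exec-preserves B←A      (cfg p a b r o)       _  (ha , hb , hr , ho) = ha , ha , hr , ho
  exec-preserves R[A]←B   (cfg p a b r o)       _  (ha , hb , hr , ho) =
    ha , hb , update-preserves r a hr hb , ho
  exec-preserves A←R[A]   (cfg p a b r o)       _  (ha , hb , hr , ho) = hr a , hb , hr , ho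
  exec-preserves (JZ l)   (cfg p zero b r o)    _  h                   = h
  exec-preserves (JZ l)   (cfg p (suc a) b r o) _  h                   = h
  exec-preserves A←N      (cfg p a b r o)       _  (ha , hb , hr , ho) = input-holds , hb , hr , ho
  exec-preserves OUT      (cfg p a b r o)       _  (ha , hb , hr , ho) =
    ha , hb , hr , ++⁺ ho (ha ∷ [])
  exec-preserves (OP f)   (cfg p a b r o)       _  (ha , hb , hr , ho) =
    op-preserves f ha hb , hb , hr , ho

  fetched-constant-holds : ∀ {k i} → fetch P k ≡ just i → Holds (constant i)
  fetched-constant-holds {i = CST j}  e = constant-holds e
  fetched-constant-holds {i = B←A}    _ = zero-holds
  fetched-constant-holds {i = R[A]←B} _ = zero-holds
  fetched-constant-holds {i = A←R[A]} _ = zero-holds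
  fetched-constant-holds {i = JZ _}   _ = zero-holds
  fetched-constant-holds {i = A←N}    _ = zero-holds
  fetched-constant-holds {i = OUT}    _ = zero-holds
  fetched-constant-holds {i = OP _}   _ = zero-holds

  run-outputs-hold : ∀ fuel c {os} → HoldsIn c → run ⟦_⟧ P N fuel c ≡ just os → All Holds os
  run-outputs-hold fuel c h e with fetch P (Config.pc c) in fetched
  run-outputs-hold fuel       (cfg _ _ _ _ o) (_ , _ , _ , ho) refl | nothing = ho
  run-outputs-hold zero       c h ()                                | just i
  run-outputs-hold (suc fuel) c h e                                 | just i =
    run-outputs-hold fuel (exec ⟦_⟧ N i c)
      (exec-preserves i c (fetched-constant-holds fetched) h) e

  init-holds : HoldsIn init
  init-holds = zero-holds , zero-holds , (λ _ → zero-holds) , []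

invariant⇒¬ComputesSucc : ∀ {Op} {⟦_⟧ : Op → ℕ → ℕ → ℕ} {P : Program Op} N → 0 < N →
                          (I : Invariant ⟦_⟧ P N) → ¬ Invariant.Holds I (suc N) →
                          ¬ ComputesSucc ⟦_⟧ P
invariant⇒¬ComputesSucc N 0<N I ¬holds computes
  with run-outputs-hold I (proj₁ (computes N 0<N)) init (init-holds I) (proj₂ (computes N 0<N))
... | holds ∷ [] = ¬holds holds

div≤ : ∀ x y → div x y ≤ x
div≤ x zero    = z≤n
div≤ x (suc y) = m/n≤m x (suc y)

bounded-invariant : (P : Program SubDivOp) → Invariant ⟦subdiv⟧ P (suc (maxConstant P))
bounded-invariant P = record
  { Holds          = _≤ suc (maxConstant P)
  ; zero-holds     = z≤n
  ; constant-holds = λ {k} e → m≤n⇒m≤1+n (fetch-CST⇒≤maxConstant P k e)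
  ; input-holds    = ≤-refl
  ; op-preserves   = λ { monus {a} {b} a≤ _ → ≤-trans (m∸n≤m a b) a≤
                       ; quot  {a} {b} a≤ _ → ≤-trans (div≤ a b) a≤ }
  }

coprime-* : ∀ {a b n} → Coprime a n → Coprime b n → Coprime (a * b) n
coprime-* {a} {b} ca cb {d} (d∣ab , d∣n) = cb (coprime-divisor d⊥a d∣ab , d∣n)
  where
  d⊥a : Coprime d a
  d⊥a = gcd≡1⇒coprime (ca (gcd[m,n]∣n d a , ∣-trans (gcd[m,n]∣m d a) d∣n))

∣⇒coprime-suc : ∀ {c n} → c ∣ n → Coprime c (suc n)
∣⇒coprime-suc {c} {n} c∣n {d} (d∣c , d∣1+n) =
  ∣1⇒≡1 (∣m+n∣m⇒∣n (subst (d ∣_) (+-comm 1 n) d∣1+n) (∣-trans d∣c c∣n))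

ZeroOrCoprimeTo : ℕ → ℕ → Set
ZeroOrCoprimeTo m v = v ≡ 0 ⊎ Coprime v m

ZeroOrCoprimeTo-* : ∀ {m a b} → ZeroOrCoprimeTo m a → ZeroOrCoprimeTo m b →
                    ZeroOrCoprimeTo m (a * b)
ZeroOrCoprimeTo-*         (inj₁ refl) _           = inj₁ refl
ZeroOrCoprimeTo-* {a = a} (inj₂ _)    (inj₁ refl) = inj₁ (*-zeroʳ a)
ZeroOrCoprimeTo-*         (inj₂ ca)   (inj₂ cb)   = inj₂ (coprime-* ca cb)

≤⇒ZeroOrCoprimeTo-1+! : ∀ {j c} → j ≤ c → ZeroOrCoprimeTo (suc (c !)) j
≤⇒ZeroOrCoprimeTo-1+! {zero}  _   = inj₁ refl
≤⇒ZeroOrCoprimeTo-1+! {suc j} j≤c =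
  inj₂ (∣⇒coprime-suc (∣-trans (m∣m*n (j !)) (m≤n⇒m!∣n! j≤c)))

coprime-invariant : (P : Program MulOp) → Invariant ⟦mul⟧ P (maxConstant P !)
coprime-invariant P = record
  { Holds          = ZeroOrCoprimeTo (suc (maxConstant P !))
  ; zero-holds     = inj₁ refl
  ; constant-holds = λ {k} e → ≤⇒ZeroOrCoprimeTo-1+! (fetch-CST⇒≤maxConstant P k e)
  ; input-holds    = inj₂ (∣⇒coprime-suc ∣-refl)
  ; op-preserves   = λ { mul → ZeroOrCoprimeTo-* }
  }

¬ZeroOrCoprimeTo-self : ∀ {m} → 1 < m → ¬ ZeroOrCoprimeTo m m
¬ZeroOrCoprimeTo-self ()  (inj₁ refl)
¬ZeroOrCoprimeTo-self 1<m (inj₂ m⊥m) = <⇒≢ 1<m (sym (m⊥m (∣-refl , ∣-refl)))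

proposition9p5 : ((P : Program SubDivOp) → ¬ ComputesSucc ⟦subdiv⟧ P)
                 × ((P : Program MulOp) → ¬ ComputesSucc ⟦mul⟧ P)
proposition9p5 = sub-div , mul-only
  where
  sub-div : (P : Program SubDivOp) → ¬ ComputesSucc ⟦subdiv⟧ P
  sub-div P = invariant⇒¬ComputesSucc _ (s≤s z≤n) (bounded-invariant P) 1+n≰n

  mul-only : (P : Program MulOp) → ¬ ComputesSucc ⟦mul⟧ P
  mul-only P = invariant⇒¬ComputesSucc _ (1≤n! (maxConstant P)) (coprime-invariant P)
                 (¬ZeroOrCoprimeTo-self (s≤s (1≤n! (maxConstant P))))
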